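{- Let $G$ be a bridgeless cubic graph with $m$ edges. If $\tau(G)\le 4$ then $scc(G)=\frac{4}{3}m$.
   Context: The perfect matching index $\tau(G)$ of a bridgeless cubic graph is the smallest integer $k$ such that there exist perfect matchings $M_1,\dots,M_k$ of $G$ whose union is $E(G)$. A cycle cover of $G$ is a collection of cycles covering every edge at least once; its length is the sum of the lengths of its cycles, and $scc(G)$ is the minimum length of a cycle cover of $G$. -}

module Defs where

open import Data.Nat using (ℕ; zero; suc; _+_; _*_; _≤_)
open import Data.Nat.Divisibility using (_∣_)
open import Data.Fin using (Fin; zero; suc)
open import Data.Bool using (Bool; true; false; _∧_; _∨_; if_then_else_)
open import Data.Product using (_×_; _,_; proj₁; proj₂; Σ; ∃)
open import Data.Sum using (_⊎_)
open import Data.List using (List; []; _∷_)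
open import Data.List.Membership.Propositional using (_∈_)
open import Relation.Binary.PropositionalEquality using (_≡_; _≢_)
open import Relation.Nullary using (¬_)
open import Relation.Nullary.Decidable using (⌊_⌋)
open import Data.Fin using (_≟_)

-- A finite loopless multigraph: vertices Fin n, edges Fin m,
-- each edge has two distinct endpoints (parallel edges allowed).
record Graph : Set where
  field
    n    : ℕ
    m    : ℕ
    ends : Fin m → Fin n × Fin n
    loopless : ∀ e → proj₁ (ends e) ≢ proj₂ (ends e)

open Graph public

countᵇ : ∀ {k} → (Fin k → Bool) → ℕ
countᵇ {zero}  f = 0
countᵇ {suc k} f = (if f zero then 1 else 0) + countᵇ (λ i → f (suc i))

EdgeSet : Graph → Set
EdgeSet G = Fin (m G) → Bool

incident : (G : Graph) → Fin (m G) → Fin (n G) → Bool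
incident G e v = ⌊ proj₁ (ends G e) ≟ v ⌋ ∨ ⌊ proj₂ (ends G e) ≟ v ⌋

degIn : (G : Graph) → EdgeSet G → Fin (n G) → ℕ
degIn G S v = countᵇ (λ e → S e ∧ incident G e v)

size : (G : Graph) → EdgeSet G → ℕ
size G S = countᵇ S

allEdges : (G : Graph) → EdgeSet G
allEdges G _ = true

degree : (G : Graph) → Fin (n G) → ℕ
degree G v = degIn G (allEdges G) v

Cubic : Graph → Set
Cubic G = ∀ v → degree G v ≡ 3

Joins : (G : Graph) → Fin (m G) → Fin (n G) → Fin (n G) → Set
Joins G f u w = (ends G f ≡ (u , w)) ⊎ (ends G f ≡ (w , u))

data ReachWithout (G : Graph) (e : Fin (m G)) (u : Fin (n G)) : Fin (n G) → Set where
  here : ReachWithout G e u u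
  step : ∀ {w w'} (f : Fin (m G)) → f ≢ e → Joins G f w w' →
         ReachWithout G e u w → ReachWithout G e u w'

IsBridge : (G : Graph) → Fin (m G) → Set
IsBridge G e = ¬ ReachWithout G e (proj₁ (ends G e)) (proj₂ (ends G e))

Bridgeless : Graph → Set
Bridgeless G = ∀ e → ¬ IsBridge G e

IsPerfectMatching : (G : Graph) → EdgeSet G → Set
IsPerfectMatching G M = ∀ v → degIn G M v ≡ 1

PMIndexAtMost : Graph → ℕ → Set
PMIndexAtMost G k =
  Σ ℕ λ j → j ≤ k × Σ (Fin j → EdgeSet G) λ M →
    (∀ i → IsPerfectMatching G (M i)) ×
    (∀ e → ∃ λ i → M i e ≡ true)

-- a cycle (in the sense of the paper's area): an even subgraph,
-- i.e. an edge set in which every vertex has even degree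
IsCycle : (G : Graph) → EdgeSet G → Set
IsCycle G C = ∀ v → 2 ∣ degIn G C v

IsCycleCover : (G : Graph) → List (EdgeSet G) → Set
IsCycleCover G Cs =
  (∀ {C} → C ∈ Cs → IsCycle G C) ×
  (∀ e → ∃ λ C → C ∈ Cs × C e ≡ true)

coverLength : (G : Graph) → List (EdgeSet G) → ℕ
coverLength G []       = 0
coverLength G (C ∷ Cs) = size G C + coverLength G Cs

-- scc(G) · 3 = 4 · m, written out: a cycle cover of length L with 3L = 4m
-- exists, and every cycle cover has length L with 3L ≥ 4m.
SccTimes3Is : (G : Graph) → ℕ → Set
SccTimes3Is G t =
  (Σ (List (EdgeSet G)) λ Cs → IsCycleCover G Cs × 3 * coverLength G Cs ≡ t) ×
  (∀ Cs → IsCycleCover G Cs → t ≤ 3 * coverLength G Cs)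

-- Given four perfect matchings covering E(G), the multiplicities of the three edges at a vertex
-- are ≥ 1 and sum to 4, so they are 2, 1, 1 and the edges covered twice form a perfect matching D.
-- The four even subgraphs Nₖ ⊕ D cover every edge exactly as often as the matchings do, so their
-- degrees at each vertex sum to 4 and, by the handshake lemma, their length is 2n = 4m/3.
-- Conversely, in any cycle cover the degrees at a vertex sum to an even number ≥ 3, hence ≥ 4,
-- which by the same count gives length ≥ 4m/3.
module Submission where

open import Defs
open import Data.Nat using (ℕ; zero; suc; _+_; _*_; _≤_; z≤n; s≤s; _≡ᵇ_)
open import Data.Nat.Properties
  using (+-*-semiring; +-comm; *-comm; *-identityʳ; +-cancelʳ-≡; *-cancelˡ-≤; *-monoʳ-≤; +-mono-≤;
         ≤-trans; ≤-antisym; ≤-reflexive; m≤n+m; ≡ᵇ⇒≡; module ≤-Reasoning)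
open import Data.Nat.Divisibility using (_∣_; divides; ∣-refl; m∣m*n; ∣m∣n⇒∣m+n; ∣m+n∣m⇒∣n)
open import Data.Fin using (Fin; zero; suc; _≟_; inject≤)
open import Data.Fin.Properties using (¬Fin0)
open import Data.Bool using (Bool; true; false; _∧_; _∨_; _xor_; if_then_else_; T)
open import Data.Bool.Properties using (∧-identityʳ; ∧-zeroʳ; xor-identityʳ)
open import Data.Product using (_×_; _,_; proj₁; proj₂; Σ; ∃)
open import Data.List using (List; []; _∷_; lookup; tabulate)
open import Data.List.Membership.Propositional.Properties using (∈-tabulate⁺; ∈-tabulate⁻; ∈-lookup)
open import Data.List.Relation.Unary.Any using (index)
open import Data.List.Relation.Unary.Any.Properties using (lookup-index)
open import Data.Empty using (⊥-elim)
open import Function using (_∘_)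
open import Relation.Binary.PropositionalEquality
open import Relation.Nullary using (yes; no; contradiction)
open import Relation.Nullary.Decidable using (⌊_⌋)
open import Data.Nat.Tactic.RingSolver using (solve-∀)
open import Algebra.Properties.Semiring.Sum +-*-semiring
  using (sum-syntax; sum-cong-≗; sum-replicate-zero; ∑-comm; ∑-distrib-+; *-distribˡ-sum)

𝟙 : Bool → ℕ
𝟙 b = if b then 1 else 0

countᵇ≡∑𝟙 : ∀ {k} (f : Fin k → Bool) → countᵇ f ≡ ∑[ i < k ] 𝟙 (f i)
countᵇ≡∑𝟙 {zero}  f = refl
countᵇ≡∑𝟙 {suc k} f = cong (𝟙 (f zero) +_) (countᵇ≡∑𝟙 (f ∘ suc))

∑-const : ∀ k c → ∑[ i < k ] c ≡ k * c
∑-const zero    c = refl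
∑-const (suc k) c = cong (c +_) (∑-const k c)

∑-mono-≤ : ∀ {k} {f g : Fin k → ℕ} → (∀ i → f i ≤ g i) → ∑[ i < k ] f i ≤ ∑[ i < k ] g i
∑-mono-≤ {zero}  f≤g = z≤n
∑-mono-≤ {suc k} f≤g = +-mono-≤ (f≤g zero) (∑-mono-≤ (f≤g ∘ suc))

∑-even : ∀ {k} (f : Fin k → ℕ) → (∀ i → 2 ∣ f i) → 2 ∣ ∑[ i < k ] f i
∑-even {zero}  f even = divides 0 refl
∑-even {suc k} f even = ∣m∣n⇒∣m+n (even zero) (∑-even (f ∘ suc) (even ∘ suc))

∑𝟙-positive : ∀ {k} (f : Fin k → Bool) {i} → f i ≡ true → 1 ≤ ∑[ j < k ] 𝟙 (f j)
∑𝟙-positive f {zero}  fi≡true rewrite fi≡true = s≤s z≤n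
∑𝟙-positive f {suc i} fi≡true = ≤-trans (∑𝟙-positive (f ∘ suc) fi≡true) (m≤n+m _ (𝟙 (f zero)))

∑𝟙-witness : ∀ {k} (f : Fin k → Bool) → 1 ≤ ∑[ j < k ] 𝟙 (f j) → ∃ λ i → f i ≡ true
∑𝟙-witness {suc k} f 1≤∑ with f zero in f0
... | true  = zero , f0
... | false = let i , fi = ∑𝟙-witness (f ∘ suc) 1≤∑ in suc i , fi

𝟙-xor-∧ : ∀ a b c → 𝟙 ((a xor b) ∧ c) + 2 * 𝟙 ((a ∧ b) ∧ c) ≡ 𝟙 (a ∧ c) + 𝟙 (b ∧ c)
𝟙-xor-∧ true  true  true  = refl
𝟙-xor-∧ true  false true  = refl
𝟙-xor-∧ false true  true  = refl
𝟙-xor-∧ false false true  = refl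
𝟙-xor-∧ true  true  false = refl
𝟙-xor-∧ true  false false = refl
𝟙-xor-∧ false true  false = refl
𝟙-xor-∧ false false false = refl

∑𝟙-xor-true : ∀ {K} (f : Fin K → Bool) → ∑[ k < K ] 𝟙 (f k xor true) + ∑[ k < K ] 𝟙 (f k) ≡ K
∑𝟙-xor-true {K} f = begin
  ∑[ k < K ] 𝟙 (f k xor true) + ∑[ k < K ] 𝟙 (f k)   ≡⟨ ∑-distrib-+ (λ k → 𝟙 (f k xor true)) (𝟙 ∘ f) ⟨
  ∑[ k < K ] (𝟙 (f k xor true) + 𝟙 (f k))           ≡⟨ sum-cong-≗ (𝟙-xor-true ∘ f) ⟩
  ∑[ k < K ] 1                                      ≡⟨ ∑-const K 1 ⟩
  K * 1                                             ≡⟨ *-identityʳ K ⟩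
  K ∎
  where
  open ≡-Reasoning
  𝟙-xor-true : ∀ a → 𝟙 (a xor true) + 𝟙 a ≡ 1
  𝟙-xor-true true  = refl
  𝟙-xor-true false = refl

3≤even⇒4≤ : ∀ {t} → 3 ≤ t → 2 ∣ t → 4 ≤ t
3≤even⇒4≤ {2} (s≤s (s≤s ())) _
3≤even⇒4≤ {3} _ (divides 0 ())
3≤even⇒4≤ {3} _ (divides 1 ())
3≤even⇒4≤ {3} _ (divides (suc (suc _)) ())
3≤even⇒4≤ {suc (suc (suc (suc _)))} _ _ = s≤s (s≤s (s≤s (s≤s z≤n)))

*-left-comm : ∀ a b c → a * (b * c) ≡ b * (a * c)
*-left-comm = solve-∀

oneOfThreeIsTwo : ∀ {a b c} → 1 ≤ a → 1 ≤ b → 1 ≤ c → a + (b + (c + 0)) ≡ 4 →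
  𝟙 (a ≡ᵇ 2) + (𝟙 (b ≡ᵇ 2) + (𝟙 (c ≡ᵇ 2) + 0)) ≡ 1
oneOfThreeIsTwo {2} {1} {1} _ _ _ _ = refl
oneOfThreeIsTwo {1} {2} {1} _ _ _ _ = refl
oneOfThreeIsTwo {1} {1} {2} _ _ _ _ = refl
oneOfThreeIsTwo {1} {1} {1} _ _ _ ()
oneOfThreeIsTwo {1} {1} {suc (suc (suc _))} _ _ _ ()
oneOfThreeIsTwo {1} {2} {suc (suc _)} _ _ _ ()
oneOfThreeIsTwo {1} {suc (suc (suc zero))} {suc _} _ _ _ ()
oneOfThreeIsTwo {1} {suc (suc (suc (suc _)))} {suc _} _ _ _ ()
oneOfThreeIsTwo {2} {1} {suc (suc _)} _ _ _ ()
oneOfThreeIsTwo {2} {2} {suc _} _ _ _ ()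
oneOfThreeIsTwo {2} {suc (suc (suc _))} {suc _} _ _ _ ()
oneOfThreeIsTwo {3} {1} {suc _} _ _ _ ()
oneOfThreeIsTwo {3} {suc (suc _)} {suc _} _ _ _ ()
oneOfThreeIsTwo {suc (suc (suc (suc zero)))} {suc _} {suc _} _ _ _ ()
oneOfThreeIsTwo {suc (suc (suc (suc (suc _))))} {suc _} {suc _} _ _ _ ()

∑𝟙-≟ : ∀ {k} (a : Fin k) → ∑[ v < k ] 𝟙 ⌊ a ≟ v ⌋ ≡ 1
∑𝟙-≟ {suc k} zero    = cong suc (sum-replicate-zero k)
∑𝟙-≟ {suc k} (suc a) = trans (sum-cong-≗ (λ v → cong 𝟙 (≟-suc a v))) (∑𝟙-≟ a)
  where
  ≟-suc : ∀ {k} (a v : Fin k) → ⌊ suc a ≟ suc v ⌋ ≡ ⌊ a ≟ v ⌋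
  ≟-suc a v with a ≟ v
  ... | yes _ = refl
  ... | no  _ = refl

𝟙-≟-∨ : ∀ {k} {a b : Fin k} → a ≢ b → ∀ v → 𝟙 (⌊ a ≟ v ⌋ ∨ ⌊ b ≟ v ⌋) ≡ 𝟙 ⌊ a ≟ v ⌋ + 𝟙 ⌊ b ≟ v ⌋
𝟙-≟-∨ {a = a} {b} a≢b v with a ≟ v | b ≟ v
... | yes refl | yes refl = contradiction refl a≢b
... | yes _    | no _     = refl
... | no _     | _        = refl

∑-endpoints : (G : Graph) (e : Fin (m G)) → ∑[ v < n G ] 𝟙 (incident G e v) ≡ 2
∑-endpoints G e = begin
  ∑[ v < n G ] 𝟙 (⌊ a ≟ v ⌋ ∨ ⌊ b ≟ v ⌋)          ≡⟨ sum-cong-≗ (𝟙-≟-∨ (loopless G e)) ⟩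
  ∑[ v < n G ] (𝟙 ⌊ a ≟ v ⌋ + 𝟙 ⌊ b ≟ v ⌋)        ≡⟨ ∑-distrib-+ (λ v → 𝟙 ⌊ a ≟ v ⌋) (λ v → 𝟙 ⌊ b ≟ v ⌋) ⟩
  ∑[ v < n G ] 𝟙 ⌊ a ≟ v ⌋ + ∑[ v < n G ] 𝟙 ⌊ b ≟ v ⌋ ≡⟨ cong₂ _+_ (∑𝟙-≟ a) (∑𝟙-≟ b) ⟩
  2 ∎
  where
  open ≡-Reasoning
  a = proj₁ (ends G e)
  b = proj₂ (ends G e)

handshake : (G : Graph) (S : EdgeSet G) → ∑[ v < n G ] degIn G S v ≡ 2 * size G S
handshake G S = begin
  ∑[ v < n G ] degIn G S v                                ≡⟨ sum-cong-≗ (λ v → countᵇ≡∑𝟙 (λ e → S e ∧ incident G e v)) ⟩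
  ∑[ v < n G ] ∑[ e < m G ] 𝟙 (S e ∧ incident G e v)      ≡⟨ ∑-comm (λ v e → 𝟙 (S e ∧ incident G e v)) ⟩
  ∑[ e < m G ] ∑[ v < n G ] 𝟙 (S e ∧ incident G e v)      ≡⟨ sum-cong-≗ edge-contribution ⟩
  ∑[ e < m G ] (2 * 𝟙 (S e))                              ≡⟨ *-distribˡ-sum 2 (𝟙 ∘ S) ⟨
  2 * ∑[ e < m G ] 𝟙 (S e)                                ≡⟨ cong (2 *_) (countᵇ≡∑𝟙 S) ⟨
  2 * size G S ∎
  where
  open ≡-Reasoning
  edge-contribution : ∀ e → ∑[ v < n G ] 𝟙 (S e ∧ incident G e v) ≡ 2 * 𝟙 (S e)
  edge-contribution e with S e
  ... | true  = ∑-endpoints G e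
  ... | false = sum-replicate-zero (n G)

size-allEdges : (G : Graph) → size G (allEdges G) ≡ m G
size-allEdges G = trans (countᵇ≡∑𝟙 (allEdges G)) (trans (∑-const (m G) 1) (*-identityʳ (m G)))

cubic-2m≡3n : (G : Graph) → Cubic G → 2 * m G ≡ 3 * n G
cubic-2m≡3n G cubic = begin
  2 * m G                      ≡⟨ cong (2 *_) (size-allEdges G) ⟨
  2 * size G (allEdges G)      ≡⟨ handshake G (allEdges G) ⟨
  ∑[ v < n G ] degree G v      ≡⟨ sum-cong-≗ cubic ⟩
  ∑[ v < n G ] 3               ≡⟨ ∑-const (n G) 3 ⟩
  n G * 3                      ≡⟨ *-comm (n G) 3 ⟩
  3 * n G ∎
  where open ≡-Reasoning

_⊕_ _∩_ : ∀ {k} → (Fin k → Bool) → (Fin k → Bool) → Fin k → Bool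
(A ⊕ B) e = A e xor B e
(A ∩ B) e = A e ∧ B e

degIn-⊕ : (G : Graph) (A B : EdgeSet G) (v : Fin (n G)) →
  degIn G (A ⊕ B) v + 2 * degIn G (A ∩ B) v ≡ degIn G A v + degIn G B v
degIn-⊕ G A B v = begin
  degIn G (A ⊕ B) v + 2 * degIn G (A ∩ B) v
    ≡⟨ cong₂ (λ x y → x + 2 * y) (countᵇ≡∑𝟙 (λ e → (A ⊕ B) e ∧ at e)) (countᵇ≡∑𝟙 (λ e → (A ∩ B) e ∧ at e)) ⟩
  ∑[ e < m G ] 𝟙 ((A ⊕ B) e ∧ at e) + 2 * ∑[ e < m G ] 𝟙 ((A ∩ B) e ∧ at e)
    ≡⟨ cong (∑[ e < m G ] 𝟙 ((A ⊕ B) e ∧ at e) +_) (*-distribˡ-sum 2 (λ e → 𝟙 ((A ∩ B) e ∧ at e))) ⟩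
  ∑[ e < m G ] 𝟙 ((A ⊕ B) e ∧ at e) + ∑[ e < m G ] (2 * 𝟙 ((A ∩ B) e ∧ at e))
    ≡⟨ ∑-distrib-+ (λ e → 𝟙 ((A ⊕ B) e ∧ at e)) (λ e → 2 * 𝟙 ((A ∩ B) e ∧ at e)) ⟨
  ∑[ e < m G ] (𝟙 ((A ⊕ B) e ∧ at e) + 2 * 𝟙 ((A ∩ B) e ∧ at e))
    ≡⟨ sum-cong-≗ (λ e → 𝟙-xor-∧ (A e) (B e) (at e)) ⟩
  ∑[ e < m G ] (𝟙 (A e ∧ at e) + 𝟙 (B e ∧ at e))
    ≡⟨ ∑-distrib-+ (λ e → 𝟙 (A e ∧ at e)) (λ e → 𝟙 (B e ∧ at e)) ⟩
  ∑[ e < m G ] 𝟙 (A e ∧ at e) + ∑[ e < m G ] 𝟙 (B e ∧ at e)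
    ≡⟨ cong₂ _+_ (countᵇ≡∑𝟙 (λ e → A e ∧ at e)) (countᵇ≡∑𝟙 (λ e → B e ∧ at e)) ⟨
  degIn G A v + degIn G B v ∎
  where
  open ≡-Reasoning
  at : Fin (m G) → Bool
  at e = incident G e v

perfectMatching-⊕-isCycle : (G : Graph) {A B : EdgeSet G} →
  IsPerfectMatching G A → IsPerfectMatching G B → IsCycle G (A ⊕ B)
perfectMatching-⊕-isCycle G {A} {B} perfectA perfectB v =
  ∣m+n∣m⇒∣n (subst (2 ∣_) 2≡2∩+⊕ ∣-refl) (m∣m*n (degIn G (A ∩ B) v))
  where
  2≡2∩+⊕ : 2 ≡ 2 * degIn G (A ∩ B) v + degIn G (A ⊕ B) v
  2≡2∩+⊕ = begin
    2                                               ≡⟨ cong₂ _+_ (perfectA v) (perfectB v) ⟨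
    degIn G A v + degIn G B v                       ≡⟨ degIn-⊕ G A B v ⟨
    degIn G (A ⊕ B) v + 2 * degIn G (A ∩ B) v       ≡⟨ +-comm (degIn G (A ⊕ B) v) _ ⟩
    2 * degIn G (A ∩ B) v + degIn G (A ⊕ B) v ∎
    where open ≡-Reasoning

Enumerates : ∀ {K} → (Fin K → Bool) → ℕ → Set
Enumerates {K} g k =
  Σ (Fin k → Fin K) λ es → ∀ (S : Fin K → Bool) → countᵇ (λ x → S x ∧ g x) ≡ ∑[ i < k ] 𝟙 (S (es i))

enumerate : ∀ {K} (g : Fin K → Bool) → Enumerates g (countᵇ g)
enumerate {zero}  g = (λ ()) , λ S → refl
enumerate {suc K} g with g zero | enumerate (g ∘ suc)
... | true  | es , count-es = (λ { zero → zero ; (suc i) → suc (es i) }) ,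
  λ S → cong₂ _+_ (cong 𝟙 (∧-identityʳ (S zero))) (count-es (S ∘ suc))
... | false | es , count-es = suc ∘ es ,
  λ S → cong₂ _+_ (cong 𝟙 (∧-zeroʳ (S zero))) (count-es (S ∘ suc))

star : (G : Graph) → Cubic G → ∀ v → Enumerates (λ e → incident G e v) 3
star G cubic v = subst (Enumerates (λ e → incident G e v)) (cubic v) (enumerate (λ e → incident G e v))

multiplicity : ∀ {K k} → (Fin K → Fin k → Bool) → Fin k → ℕ
multiplicity {K} F e = ∑[ j < K ] 𝟙 (F j e)

degreeSum : (G : Graph) {K : ℕ} → (Fin K → EdgeSet G) → Fin (n G) → ℕ
degreeSum G {K} F v = ∑[ k < K ] degIn G (F k) v

familyLength : (G : Graph) {K : ℕ} → (Fin K → EdgeSet G) → ℕ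
familyLength G {K} F = ∑[ k < K ] size G (F k)

2*familyLength≡∑degreeSum : (G : Graph) {K : ℕ} (F : Fin K → EdgeSet G) →
  2 * familyLength G F ≡ ∑[ v < n G ] degreeSum G F v
2*familyLength≡∑degreeSum G {K} F = begin
  2 * ∑[ k < K ] size G (F k)                  ≡⟨ *-distribˡ-sum 2 (λ k → size G (F k)) ⟩
  ∑[ k < K ] (2 * size G (F k))                ≡⟨ sum-cong-≗ (λ k → handshake G (F k)) ⟨
  ∑[ k < K ] ∑[ v < n G ] degIn G (F k) v      ≡⟨ ∑-comm (λ k v → degIn G (F k) v) ⟩
  ∑[ v < n G ] degreeSum G F v ∎
  where open ≡-Reasoning

CoveringMatchings : Graph → ℕ → Set
CoveringMatchings G K =
  Σ (Fin K → EdgeSet G) λ N → (∀ k → IsPerfectMatching G (N k)) × (∀ e → ∃ λ k → N k e ≡ true)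

clamp : ∀ {K j} → Fin K → Fin (suc j)
clamp zero                = zero
clamp {j = zero}  (suc _) = zero
clamp {j = suc _} (suc k) = suc (clamp k)

clamp-inject≤ : ∀ {K j} (i : Fin (suc j)) (j<K : suc j ≤ K) → clamp (inject≤ i j<K) ≡ i
clamp-inject≤ {suc _} zero    _   = refl
clamp-inject≤ {suc _} {suc _} (suc i) (s≤s j<K) = cong suc (clamp-inject≤ i j<K)

isCycleCover-tabulate : (G : Graph) {K : ℕ} (F : Fin K → EdgeSet G) → (∀ k → IsCycle G (F k)) →
  (∀ e → ∃ λ k → F k e ≡ true) → IsCycleCover G (tabulate F)
isCycleCover-tabulate G F cycles covers =
  (λ C∈F → let k , C≡Fk = ∈-tabulate⁻ C∈F in subst (IsCycle G) (sym C≡Fk) (cycles k)) ,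
  (λ e → let k , Fke = covers e in F k , ∈-tabulate⁺ k , Fke)

lookup-covers : (G : Graph) (Cs : List (EdgeSet G)) → IsCycleCover G Cs →
  ∀ e → ∃ λ k → lookup Cs k e ≡ true
lookup-covers G Cs (_ , covers) e =
  let C , C∈Cs , Ce = covers e in index C∈Cs , subst (λ X → X e ≡ true) (lookup-index C∈Cs) Ce

coverLength-tabulate : (G : Graph) {K : ℕ} (F : Fin K → EdgeSet G) →
  coverLength G (tabulate F) ≡ familyLength G F
coverLength-tabulate G {zero}  F = refl
coverLength-tabulate G {suc K} F = cong (size G (F zero) +_) (coverLength-tabulate G (F ∘ suc))

coverLength-lookup : (G : Graph) (Cs : List (EdgeSet G)) → coverLength G Cs ≡ familyLength G (lookup Cs)
coverLength-lookup G []       = refl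
coverLength-lookup G (C ∷ Cs) = cong (size G C +_) (coverLength-lookup G Cs)

module CubicGraph {G : Graph} (cubic : Cubic G) where

  edgeAt : Fin (n G) → Fin 3 → Fin (m G)
  edgeAt v = proj₁ (star G cubic v)

  degIn-edgeAt : ∀ S v → degIn G S v ≡ ∑[ i < 3 ] 𝟙 (S (edgeAt v i))
  degIn-edgeAt S v = proj₂ (star G cubic v) S

  degreeSum-edgeAt : ∀ {K} (F : Fin K → EdgeSet G) v →
    degreeSum G F v ≡ ∑[ i < 3 ] multiplicity F (edgeAt v i)
  degreeSum-edgeAt F v =
    trans (sum-cong-≗ (λ k → degIn-edgeAt (F k) v)) (∑-comm (λ k i → 𝟙 (F k (edgeAt v i))))

  cycleCover-degreeSum≥4 : ∀ {K} (F : Fin K → EdgeSet G) → (∀ k → IsCycle G (F k)) →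
    (∀ e → ∃ λ k → F k e ≡ true) → ∀ v → 4 ≤ degreeSum G F v
  cycleCover-degreeSum≥4 F cycles covers v = 3≤even⇒4≤ degreeSum≥3 (∑-even _ (λ k → cycles k v))
    where
    degreeSum≥3 : 3 ≤ degreeSum G F v
    degreeSum≥3 = subst (3 ≤_) (sym (degreeSum-edgeAt F v))
      (∑-mono-≤ (λ i → let k , Fke = covers (edgeAt v i) in ∑𝟙-positive (λ k → F k (edgeAt v i)) Fke))

  2*[4*m]≡3*∑4 : 2 * (4 * m G) ≡ 3 * ∑[ v < n G ] 4
  2*[4*m]≡3*∑4 = begin
    2 * (4 * m G)        ≡⟨ *-left-comm 2 4 (m G) ⟩
    4 * (2 * m G)        ≡⟨ cong (4 *_) (cubic-2m≡3n G cubic) ⟩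
    4 * (3 * n G)        ≡⟨ *-left-comm 4 3 (n G) ⟩
    3 * (4 * n G)        ≡⟨ cong (3 *_) (trans (*-comm 4 (n G)) (sym (∑-const (n G) 4))) ⟩
    3 * ∑[ v < n G ] 4 ∎
    where open ≡-Reasoning

  2*[3*familyLength]≡3*∑degreeSum : ∀ {K} (F : Fin K → EdgeSet G) →
    2 * (3 * familyLength G F) ≡ 3 * ∑[ v < n G ] degreeSum G F v
  2*[3*familyLength]≡3*∑degreeSum F =
    trans (*-left-comm 2 3 (familyLength G F)) (cong (3 *_) (2*familyLength≡∑degreeSum G F))

  degreeSum≥4⇒4*m≤3*familyLength : ∀ {K} (F : Fin K → EdgeSet G) → (∀ v → 4 ≤ degreeSum G F v) →
    4 * m G ≤ 3 * familyLength G F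
  degreeSum≥4⇒4*m≤3*familyLength F 4≤ = *-cancelˡ-≤ 2 (begin
    2 * (4 * m G)                       ≡⟨ 2*[4*m]≡3*∑4 ⟩
    3 * ∑[ v < n G ] 4                  ≤⟨ *-monoʳ-≤ 3 (∑-mono-≤ 4≤) ⟩
    3 * ∑[ v < n G ] degreeSum G F v    ≡⟨ 2*[3*familyLength]≡3*∑degreeSum F ⟨
    2 * (3 * familyLength G F) ∎)
    where open ≤-Reasoning

  degreeSum≤4⇒3*familyLength≤4*m : ∀ {K} (F : Fin K → EdgeSet G) → (∀ v → degreeSum G F v ≤ 4) →
    3 * familyLength G F ≤ 4 * m G
  degreeSum≤4⇒3*familyLength≤4*m F ≤4 = *-cancelˡ-≤ 2 (begin
    2 * (3 * familyLength G F)          ≡⟨ 2*[3*familyLength]≡3*∑degreeSum F ⟩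
    3 * ∑[ v < n G ] degreeSum G F v    ≤⟨ *-monoʳ-≤ 3 (∑-mono-≤ ≤4) ⟩
    3 * ∑[ v < n G ] 4                  ≡⟨ 2*[4*m]≡3*∑4 ⟨
    2 * (4 * m G) ∎)
    where open ≤-Reasoning

  cycleCover-length≥ : ∀ Cs → IsCycleCover G Cs → 4 * m G ≤ 3 * coverLength G Cs
  cycleCover-length≥ Cs cover@(cycles , _) =
    subst (λ L → 4 * m G ≤ 3 * L) (sym (coverLength-lookup G Cs))
      (degreeSum≥4⇒4*m≤3*familyLength (lookup Cs)
        (cycleCover-degreeSum≥4 (lookup Cs) (cycles ∘ ∈-lookup) (lookup-covers G Cs cover)))

  -- A family of j + 1 ≤ 4 matchings is padded by repeating its last member; with no matchings at
  -- all there are no edges, so the cubic graph has no vertices.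
  coveringMatchings-pad : PMIndexAtMost G 4 → CoveringMatchings G 4
  coveringMatchings-pad (zero , _ , _ , _ , covers) =
    (λ _ _ → false) , (λ _ v → ⊥-elim (¬Fin0 (proj₁ (covers (edgeAt v zero))))) , (⊥-elim ∘ ¬Fin0 ∘ proj₁ ∘ covers)
  coveringMatchings-pad (suc j , j<4 , M , perfect , covers) =
    M ∘ clamp , perfect ∘ clamp ,
    λ e → let i , Mie = covers e in inject≤ i j<4 , subst (λ i → M i e ≡ true) (sym (clamp-inject≤ i j<4)) Mie

  module FourMatchings (N : Fin 4 → EdgeSet G) (perfect : ∀ k → IsPerfectMatching G (N k))
                       (covers : ∀ e → ∃ λ k → N k e ≡ true) where

    doubled : EdgeSet G
    doubled e = multiplicity N e ≡ᵇ 2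

    cycle : Fin 4 → EdgeSet G
    cycle k = N k ⊕ doubled

    multiplicity≥1 : ∀ e → 1 ≤ multiplicity N e
    multiplicity≥1 e = let k , Nke = covers e in ∑𝟙-positive (λ k → N k e) Nke

    multiplicity-edgeAt : ∀ v → ∑[ i < 3 ] multiplicity N (edgeAt v i) ≡ 4
    multiplicity-edgeAt v = trans (sym (degreeSum-edgeAt N v)) (sum-cong-≗ (λ k → perfect k v))

    doubled-perfect : IsPerfectMatching G doubled
    doubled-perfect v = trans (degIn-edgeAt doubled v)
      (oneOfThreeIsTwo (multiplicity≥1 _) (multiplicity≥1 _) (multiplicity≥1 _) (multiplicity-edgeAt v))

    cycle-isCycle : ∀ k → IsCycle G (cycle k)
    cycle-isCycle k = perfectMatching-⊕-isCycle G (perfect k) doubled-perfect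

    multiplicity-cycle : ∀ e → ∑[ k < 4 ] 𝟙 (N k e xor doubled e) ≡ multiplicity N e
    multiplicity-cycle e with doubled e in doubled-e
    ... | false = sum-cong-≗ (λ k → cong 𝟙 (xor-identityʳ (N k e)))
    -- A doubled edge lies in Nₖ ⊕ D exactly for the 4 − 2 = 2 matchings Nₖ avoiding it.
    ... | true  = trans (+-cancelʳ-≡ 2 flipped 2 (subst (λ μ → flipped + μ ≡ 4) mult≡2 (∑𝟙-xor-true (λ k → N k e))))
                        (sym mult≡2)
      where
      flipped : ℕ
      flipped = ∑[ k < 4 ] 𝟙 (N k e xor true)

      mult≡2 : multiplicity N e ≡ 2
      mult≡2 = ≡ᵇ⇒≡ (multiplicity N e) 2 (subst T (sym doubled-e) _)

    cycle-covers : ∀ e → ∃ λ k → cycle k e ≡ true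
    cycle-covers e = ∑𝟙-witness (λ k → cycle k e) (subst (1 ≤_) (sym (multiplicity-cycle e)) (multiplicity≥1 e))

    degreeSum-cycle : ∀ v → degreeSum G cycle v ≡ 4
    degreeSum-cycle v = begin
      degreeSum G cycle v                          ≡⟨ degreeSum-edgeAt cycle v ⟩
      ∑[ i < 3 ] multiplicity cycle (edgeAt v i)   ≡⟨ sum-cong-≗ (multiplicity-cycle ∘ edgeAt v) ⟩
      ∑[ i < 3 ] multiplicity N (edgeAt v i)       ≡⟨ multiplicity-edgeAt v ⟩
      4 ∎
      where open ≡-Reasoning

    cycleCover : IsCycleCover G (tabulate cycle)
    cycleCover = isCycleCover-tabulate G cycle cycle-isCycle cycle-covers

    cycleCover-length≤ : 3 * coverLength G (tabulate cycle) ≤ 4 * m G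
    cycleCover-length≤ = subst (λ L → 3 * L ≤ 4 * m G) (sym (coverLength-tabulate G cycle))
      (degreeSum≤4⇒3*familyLength≤4*m cycle (≤-reflexive ∘ degreeSum-cycle))

-- Bridgelessness only makes τ(G) well defined; the matchings witnessing τ(G) ≤ 4 are all we use.
theorem5p3 : (G : Graph) → Cubic G → Bridgeless G → PMIndexAtMost G 4 →
    SccTimes3Is G (4 * m G)
theorem5p3 G cubic _ τ≤4 with CubicGraph.coveringMatchings-pad {G} cubic τ≤4
... | N , perfect , covers =
  (tabulate cycle , cycleCover , ≤-antisym cycleCover-length≤ (cycleCover-length≥ _ cycleCover)) ,
  cycleCover-length≥
  where
  open CubicGraph {G} cubic
  open FourMatchings N perfect covers
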